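{- Let $U$ and $Z$ be disjoint finite sets, let $(t_v:v\in U)$ and $(d_v:v\in U)$ be natural numbers with $t_v\le d_v\le|Z|$. For a bipartite graph $F$ on $U\cup Z$ with $d_F(v)=d_v$ for all $v\in U$, let $L_F$ be the random subgraph of $F$ obtained by choosing, independently for each $v\in U$, a neighborhood $N_{L_F}(v)$ uniformly from the $t_v$-element subsets of $N_F(v)$. Then, over all such $F$, the probability that $L_F$ admits a $U$-perfect matching is minimized when, for some ordering of $Z$, each $v\in U$ is adjacent to exactly the first $d_v$ vertices of $Z$.
   Context: A $U$-perfect matching is a matching covering every vertex of $U$. -}

module Defs where

open import Data.Nat using (ℕ; zero; suc)
open import Data.Bool using (Bool; true; false)
open import Data.Fin using (Fin; _≟_)
open import Data.Fin.Properties using (any?; all?)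
open import Data.Fin.Subset using (Subset; _∈_; _⊆_; ∣_∣; inside; outside)
open import Data.Fin.Subset.Properties using (_∈?_; _⊆?_)
open import Data.Vec using (Vec; []; _∷_; lookup; tabulate)
open import Data.Vec.Properties using (lookup∘tabulate)
open import Data.List using (List; []; _∷_; map; _++_; concatMap; length; filter)
open import Data.Product using (Σ; ∃; _×_; _,_; proj₁; proj₂)
open import Function.Definitions using (Injective)
open import Relation.Nullary using (Dec; yes; no; ¬_)
open import Relation.Nullary.Decidable using (_×-dec_; _→-dec_; map′)
import Data.Nat as ℕ
open import Relation.Binary.PropositionalEquality using (_≡_; refl; subst; sym; trans)

-- Setting: U = Fin m, Z = Fin n (disjoint finite sets).
BipGraph : ℕ → ℕ → Set
BipGraph m n = Fin m → Subset n

UPerfectMatching : ∀ {m n} → BipGraph m n → Set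
UPerfectMatching {m} {n} G =
  Σ (Fin m → Fin n) λ f → Injective _≡_ _≡_ f × (∀ v → f v ∈ G v)

allSubsets : (n : ℕ) → List (Subset n)
allSubsets zero = [] ∷ []
allSubsets (suc n) = map (outside ∷_) (allSubsets n) ++ map (inside ∷_) (allSubsets n)

allVecs : ∀ {A : Set} → List A → (m : ℕ) → List (Vec A m)
allVecs xs zero = [] ∷ []
allVecs xs (suc m) = concatMap (λ x → map (x ∷_) (allVecs xs m)) xs

Outcome : ∀ {m n} → (t : Fin m → ℕ) → BipGraph m n → Vec (Subset n) m → Set
Outcome {m} t F L = ∀ v → (lookup L v ⊆ F v) × (∣ lookup L v ∣ ≡ t v)

outcome? : ∀ {m n} (t : Fin m → ℕ) (F : BipGraph m n) (L : Vec (Subset n) m) → Dec (Outcome t F L)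
outcome? t F L = all? (λ v → (lookup L v ⊆? F v) ×-dec (∣ lookup L v ∣ ℕ.≟ t v))

private
  vec-any? : ∀ {n} m {P : Vec (Fin n) m → Set} → (∀ w → Dec (P w)) → Dec (∃ P)
  vec-any? zero P? = map′ (λ p → [] , p) (λ { ([] , p) → p }) (P? [])
  vec-any? (suc m) P? =
    map′ (λ { (a , w , p) → a ∷ w , p }) (λ { (a ∷ w , p) → a , w , p })
         (any? (λ a → vec-any? m (λ w → P? (a ∷ w))))

  inj? : ∀ {m n} (f : Fin m → Fin n) → Dec (Injective _≡_ _≡_ f)
  inj? f = map′ (λ h {x} {y} → h x y) (λ h x y → h {x} {y})
             (all? (λ x → all? (λ y → (f x ≟ f y) →-dec (x ≟ y))))

matching? : ∀ {m n} (G : BipGraph m n) → Dec (UPerfectMatching G)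
matching? {m} {n} G =
  map′ (λ { (w , i , c) → lookup w , (λ {x} {y} → i {x} {y}) , c })
       (λ { (f , i , c) → tabulate f
                        , (λ {x} {y} e → i (trans (sym (lookup∘tabulate f x))
                                             (trans e (lookup∘tabulate f y))))
                        , (λ v → subst (_∈ G v) (sym (lookup∘tabulate f v)) (c v)) })
       (vec-any? m (λ w → inj? (lookup w) ×-dec all? (λ v → lookup w v ∈? G v)))

subgraph : ∀ {m n} → Vec (Subset n) m → BipGraph m n
subgraph L v = lookup L v

-- Number of all outcomes (the sample space of L_F; each outcome is
-- equally likely since the choices are independent and uniform).
#outcomes : ∀ {m n} (t : Fin m → ℕ) (F : BipGraph m n) → ℕ
#outcomes {m} {n} t F = length (filter (outcome? t F) (allVecs (allSubsets n) m))

#matchable : ∀ {m n} (t : Fin m → ℕ) (F : BipGraph m n) → ℕ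
#matchable {m} {n} t F =
  length (filter (λ L → outcome? t F L ×-dec matching? (subgraph L))
                 (allVecs (allSubsets n) m))
-- Pr[L_F admits a U-perfect matching] = #matchable t F / #outcomes t F.

{-# OPTIONS --safe #-}
module Submission where

-- Compressing b into a (replacing b by a in every neighbourhood that contains b but not a) preserves
-- the degrees and the number of outcomes, and does not increase the number of outcomes with a
-- U-perfect matching. An injection witnesses the latter: undo the compression, and if that destroys
-- every matching, first swap a and b in the rows containing both. The two cases cannot collide by an
-- exchange (alternating path) argument: if an outcome and its swap in the rows containing both are
-- matchable, so is the outcome with the compression undone. Any F with the degrees of a nested family
-- F₀ is turned into F₀ by compressions, each strictly decreasing the number of edges of F outside F₀.

open import Level using (0ℓ)
open import Function using (id; const; _∘_; _∘′_)
open import Function.Bundles using (_⇔_; mk⇔; Equivalence)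
open import Function.Definitions using (Injective)
open import Data.Empty using (⊥-elim)
open import Data.Bool using (Bool; false; true)
open import Data.Product using (Σ; ∃; _×_; _,_; proj₁; proj₂)
import Data.Product as Product
open import Data.Sum using (_⊎_; inj₁; inj₂; [_,_])
open import Data.Nat using (ℕ; zero; suc; _+_; _*_; _≤_; _<_; z≤n; s≤s)
open import Data.Nat.Properties
  using (≤-refl; ≤-trans; ≤-reflexive; ≤-antisym; <-irrefl; <-≤-trans; ≤-total; n≮0; +-suc;
         +-mono-≤; +-mono-<-≤; +-mono-≤-<; *-monoˡ-≤; +-0-commutativeMonoid; module ≤-Reasoning)
open import Data.Nat.Induction using (<-wellFounded)
open import Induction.WellFounded using (Acc; acc)
open import Algebra.Properties.CommutativeMonoid.Sum +-0-commutativeMonoid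
  using (sum; sum-permute; sum-cong-≗)
open import Data.Fin using (Fin; zero; suc; toℕ; _≟_)
open import Data.Fin.Properties using (any?; all?; ¬∀⟶∃¬)
open import Data.Fin.Permutation using (Permutation′; _⟨$⟩ʳ_; transpose)
open import Data.Fin.Subset using (Subset; _∈_; _∉_; _⊆_; ∣_∣; inside; outside; _-_; ⊤; _∩_; ∁)
open import Data.Fin.Subset.Properties
  using (_∈?_; _⊆?_; ⊆-antisym; ⊆-reflexive; p⊆q⇒∣p∣≤∣q∣; p⊂q⇒∣p∣<∣q∣; x∈p∩q⁺; x∈p∩q⁻;
         x∉p⇒x∈∁p; x∈∁p⇒x∉p; ∈⊤; x∈p⇒∣p-x∣<∣p∣; x∈p∧x≢y⇒x∈p-y)
open import Data.Vec using (Vec; []; _∷_; here; there; lookup; tabulate)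
open import Data.Vec.Properties
  using (∷-injective; tabulate-cong; tabulate∘lookup; lookup∘tabulate; []=⇒lookup; lookup⇒[]=)
open import Data.Vec.Functional using (updateAt)
open import Data.Vec.Functional.Properties using (updateAt-updates; updateAt-minimal)
open import Data.List using (List; []; _∷_; _++_; map; concatMap; length; filter; cartesianProductWith)
open import Data.List.Properties using (length-++; length-map; ++-identityʳ; filter-≐)
open import Data.List.Membership.Propositional using () renaming (_∈_ to _∈ₗ_)
open import Data.List.Membership.Propositional.Properties
  using (∈-∃++; ∈-++⁻; ∈-++⁺ˡ; ∈-++⁺ʳ; ∈-map⁻; ∈-filter⁺; ∈-filter⁻; ∈-cartesianProductWith⁺)
open import Data.List.Relation.Binary.Subset.Propositional using () renaming (_⊆_ to _⊆ₗ_)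
open import Data.List.Relation.Unary.All as All using (All; []; _∷_)
open import Data.List.Relation.Unary.All.Properties using (all-filter) renaming (map⁺ to All-map⁺)
open import Data.List.Relation.Unary.Any using (here; there)
open import Data.List.Relation.Unary.Unique.Propositional using (Unique; []; _∷_)
import Data.List.Relation.Unary.Unique.Propositional.Properties as Unique
open import Relation.Nullary using (¬_; Dec; yes; no; ¬?)
open import Relation.Nullary.Decidable using (_×-dec_; _⊎-dec_; _→-dec_)
open import Relation.Unary using (Pred; Decidable; _∪_; ｛_｝; ∅)
open import Relation.Binary.PropositionalEquality
  using (_≡_; _≢_; _≗_; refl; sym; trans; cong; subst; module ≡-Reasoning)
open import Defs

-- Counting outcomes by injections

module _ {A : Set} where

  Unique∧⊆⇒length≤ : ∀ {xs ys : List A} → Unique xs → xs ⊆ₗ ys → length xs ≤ length ys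
  Unique∧⊆⇒length≤ {[]} _ _ = z≤n
  Unique∧⊆⇒length≤ {x ∷ xs} {ys} (x∉xs ∷ xs!) xs⊆ys with ∈-∃++ (xs⊆ys (here refl))
  ... | us , vs , refl = begin
    suc (length xs)             ≤⟨ s≤s (Unique∧⊆⇒length≤ xs! xs⊆us++vs) ⟩
    suc (length (us ++ vs))     ≡⟨ cong suc (length-++ us) ⟩
    suc (length us + length vs) ≡⟨ +-suc (length us) (length vs) ⟨
    length us + suc (length vs) ≡⟨ length-++ us ⟨
    length (us ++ x ∷ vs)       ∎
    where
    open ≤-Reasoning
    xs⊆us++vs : xs ⊆ₗ us ++ vs
    xs⊆us++vs z∈xs with ∈-++⁻ us (xs⊆ys (there z∈xs))
    ... | inj₁ z∈us         = ∈-++⁺ˡ z∈us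
    ... | inj₂ (here refl)  = ⊥-elim (All.lookup x∉xs z∈xs refl)
    ... | inj₂ (there z∈vs) = ∈-++⁺ʳ us z∈vs

module _ {A B : Set} {P : A → Set} {Q : B → Set} (P? : Decidable P) (Q? : Decidable Q)
         (f : A → B) (f-maps : ∀ {x} → P x → Q (f x))
         (f-injective : ∀ {x x′} → P x → P x′ → f x ≡ f x′ → x ≡ x′) where

  private
    Unique-map : ∀ {xs} → All P xs → Unique xs → Unique (map f xs)
    Unique-map []         []           = []
    Unique-map (px ∷ pxs) (x∉xs ∷ xs!) =
      All-map⁺ (All.zipWith (λ (px′ , x≢x′) → x≢x′ ∘′ f-injective px px′) (pxs , x∉xs))
      ∷ Unique-map pxs xs!

  count-≤-injection : ∀ {xs ys} → Unique xs → (∀ y → y ∈ₗ ys) →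
                      length (filter P? xs) ≤ length (filter Q? ys)
  count-≤-injection {xs} {ys} xs! ys-complete = begin
    length (filter P? xs)         ≡⟨ length-map f (filter P? xs) ⟨
    length (map f (filter P? xs)) ≤⟨ Unique∧⊆⇒length≤ image! image⊆ ⟩
    length (filter Q? ys)         ∎
    where
    open ≤-Reasoning
    image! : Unique (map f (filter P? xs))
    image! = Unique-map (all-filter P? xs) (Unique.filter⁺ P? xs!)
    image⊆ : map f (filter P? xs) ⊆ₗ filter Q? ys
    image⊆ y∈ with ∈-map⁻ f y∈
    ... | x , x∈ , refl = ∈-filter⁺ Q? (ys-complete (f x)) (f-maps (proj₂ (∈-filter⁻ P? {xs = xs} x∈)))

module _ {A : Set} (xs : List A) where

  allVecs-suc : ∀ m → allVecs xs (suc m) ≡ cartesianProductWith _∷_ xs (allVecs xs m)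
  allVecs-suc m = go xs
    where
    go : ∀ ys → concatMap (λ y → map (y ∷_) (allVecs xs m)) ys
              ≡ cartesianProductWith _∷_ ys (allVecs xs m)
    go []       = refl
    go (y ∷ ys) = cong (map (y ∷_) (allVecs xs m) ++_) (go ys)

  allVecs-unique : Unique xs → ∀ m → Unique (allVecs xs m)
  allVecs-unique xs! zero    = [] ∷ []
  allVecs-unique xs! (suc m) rewrite allVecs-suc m =
    Unique.cartesianProductWith⁺ _∷_ ∷-injective xs! (allVecs-unique xs! m)

  allVecs-complete : (∀ x → x ∈ₗ xs) → ∀ {m} (v : Vec A m) → v ∈ₗ allVecs xs m
  allVecs-complete xs-complete []                = here refl
  allVecs-complete xs-complete {suc m} (x ∷ v) rewrite allVecs-suc m =
    ∈-cartesianProductWith⁺ _∷_ (xs-complete x) (allVecs-complete xs-complete v)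

allSubsets≡allVecs : ∀ n → allSubsets n ≡ allVecs (outside ∷ inside ∷ []) n
allSubsets≡allVecs zero    = refl
allSubsets≡allVecs (suc n) rewrite allSubsets≡allVecs n =
  cong (map (outside ∷_) (allVecs _ n) ++_) (sym (++-identityʳ _))

allFamilies-unique : ∀ m n → Unique (allVecs (allSubsets n) m)
allFamilies-unique m n = allVecs-unique (allSubsets n) allSubsets-unique m
  where
  allSubsets-unique : Unique (allSubsets n)
  allSubsets-unique rewrite allSubsets≡allVecs n =
    allVecs-unique _ (((λ ()) ∷ []) ∷ [] ∷ []) n

allFamilies-complete : ∀ {m n} (L : Vec (Subset n) m) → L ∈ₗ allVecs (allSubsets n) m
allFamilies-complete {n = n} = allVecs-complete (allSubsets n) allSubsets-complete
  where
  allSubsets-complete : ∀ p → p ∈ₗ allSubsets n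
  allSubsets-complete p rewrite allSubsets≡allVecs n = allVecs-complete _ bool-complete p
    where
    bool-complete : ∀ b → b ∈ₗ outside ∷ inside ∷ []
    bool-complete false = here refl
    bool-complete true  = there (here refl)

outcome-resp-≗ : ∀ {m n} {t : Fin m → ℕ} {F G : BipGraph m n} → F ≗ G →
                 ∀ L → Outcome t F L → Outcome t G L
outcome-resp-≗ F≗G L L-outcome v = subst (_ ∈_) (F≗G v) ∘ proj₁ (L-outcome v) , proj₂ (L-outcome v)

module _ {m n : ℕ} (t : Fin m → ℕ) {F G : BipGraph m n} (F≗G : F ≗ G) where

  #outcomes-resp-≗ : #outcomes t F ≡ #outcomes t G
  #outcomes-resp-≗ = cong length (filter-≐ (outcome? t F) (outcome? t G)
    ((λ {L} → outcome-resp-≗ F≗G L) , (λ {L} → outcome-resp-≗ (sym ∘ F≗G) L))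
    (allVecs (allSubsets n) m))

  #matchable-resp-≗ : #matchable t F ≡ #matchable t G
  #matchable-resp-≗ = cong length (filter-≐
    (λ L → outcome? t F L ×-dec matching? (subgraph L))
    (λ L → outcome? t G L ×-dec matching? (subgraph L))
    ((λ {L} → Product.map₁ (outcome-resp-≗ F≗G L)) , (λ {L} → Product.map₁ (outcome-resp-≗ (sym ∘ F≗G) L)))
    (allVecs (allSubsets n) m))

module _ {n : ℕ} where

  permute : Permutation′ n → Subset n → Subset n
  permute π p = tabulate (λ z → lookup p (π ⟨$⟩ʳ z))

  ∈-permute⁺ : ∀ π {p z} → π ⟨$⟩ʳ z ∈ p → z ∈ permute π p
  ∈-permute⁺ π {p} {z} πz∈p = lookup⇒[]= z _ (trans (lookup∘tabulate _ z) ([]=⇒lookup πz∈p))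

  ∈-permute⁻ : ∀ π {p z} → z ∈ permute π p → π ⟨$⟩ʳ z ∈ p
  ∈-permute⁻ π {p} {z} z∈πp = lookup⇒[]= _ p (trans (sym (lookup∘tabulate _ z)) ([]=⇒lookup z∈πp))

  private
    indicator : Bool → ℕ
    indicator false = 0
    indicator true  = 1

    ∣p∣≡sum : ∀ {k} (p : Subset k) → ∣ p ∣ ≡ sum (λ z → indicator (lookup p z))
    ∣p∣≡sum []          = refl
    ∣p∣≡sum (false ∷ p) = ∣p∣≡sum p
    ∣p∣≡sum (true ∷ p)  = cong suc (∣p∣≡sum p)

  ∣permute∣ : ∀ π p → ∣ permute π p ∣ ≡ ∣ p ∣
  ∣permute∣ π p = begin
    ∣ permute π p ∣                                ≡⟨ ∣p∣≡sum (permute π p) ⟩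
    sum (λ z → indicator (lookup (permute π p) z)) ≡⟨ sum-cong-≗ (cong indicator ∘ lookup∘tabulate πp) ⟩
    sum (λ z → indicator (lookup p (π ⟨$⟩ʳ z)))    ≡⟨ sum-permute (indicator ∘ lookup p) π ⟨
    sum (λ z → indicator (lookup p z))             ≡⟨ ∣p∣≡sum p ⟨
    ∣ p ∣                                          ∎
    where
    open ≡-Reasoning
    πp = λ z → lookup p (π ⟨$⟩ʳ z)

module _ {n : ℕ} where

  ⊈⇒∃∉ : ∀ {p q : Subset n} → ¬ p ⊆ q → ∃ λ z → z ∈ p × z ∉ q
  ⊈⇒∃∉ {p} {q} p⊈q with ¬∀⟶∃¬ n _ (λ z → z ∈? p →-dec z ∈? q) (λ p⊆q → p⊈q (p⊆q _))
  ... | z , z∈p⇏z∈q with z ∈? p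
  ...   | yes z∈p = z , z∈p , z∈p⇏z∈q ∘ const
  ...   | no z∉p  = ⊥-elim (z∈p⇏z∈q (⊥-elim ∘ z∉p))

  ⊆∧∣≡∣⇒≡ : ∀ {p q : Subset n} → p ⊆ q → ∣ p ∣ ≡ ∣ q ∣ → p ≡ q
  ⊆∧∣≡∣⇒≡ {p} {q} p⊆q ∣p∣≡∣q∣ with q ⊆? p
  ... | yes q⊆p = ⊆-antisym p⊆q q⊆p
  ... | no q⊈p  = ⊥-elim (<-irrefl ∣p∣≡∣q∣ (p⊂q⇒∣p∣<∣q∣ (p⊆q , ⊈⇒∃∉ q⊈p)))

initialSegment : ∀ {n} → ℕ → Subset n
initialSegment {zero}  _       = []
initialSegment {suc n} zero    = outside ∷ initialSegment zero
initialSegment {suc n} (suc d) = inside ∷ initialSegment d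

∣initialSegment∣ : ∀ {n d} → d ≤ n → ∣ initialSegment {n} d ∣ ≡ d
∣initialSegment∣ {zero}  z≤n       = refl
∣initialSegment∣ {suc n} z≤n       = ∣initialSegment∣ {n} z≤n
∣initialSegment∣ {suc n} (s≤s d≤n) = cong suc (∣initialSegment∣ d≤n)

∈initialSegment⁺ : ∀ {n d} {z : Fin n} → toℕ z < d → z ∈ initialSegment d
∈initialSegment⁺ {z = zero}  (s≤s _)   = here
∈initialSegment⁺ {z = suc z} (s≤s z<d) = there (∈initialSegment⁺ z<d)

∈initialSegment⁻ : ∀ {n d} {z : Fin n} → z ∈ initialSegment d → toℕ z < d
∈initialSegment⁻ {d = zero}  (there z∈) = ⊥-elim (n≮0 (∈initialSegment⁻ z∈))
∈initialSegment⁻ {d = suc d} here       = s≤s z≤n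
∈initialSegment⁻ {d = suc d} (there z∈) = s≤s (∈initialSegment⁻ z∈)

sum-mono-≤ : ∀ {k} {f g : Fin k → ℕ} → (∀ i → f i ≤ g i) → sum f ≤ sum g
sum-mono-≤ {zero}  _   = z≤n
sum-mono-≤ {suc k} f≤g = +-mono-≤ (f≤g zero) (sum-mono-≤ (f≤g ∘ suc))

sum-mono-< : ∀ {k} {f g : Fin k → ℕ} → (∀ i → f i ≤ g i) → ∀ j → f j < g j → sum f < sum g
sum-mono-< f≤g zero    fj<gj = +-mono-<-≤ fj<gj (sum-mono-≤ (f≤g ∘ suc))
sum-mono-< f≤g (suc j) fj<gj = +-mono-≤-< (f≤g zero) (sum-mono-< (f≤g ∘ suc) j fj<gj)

excess : ∀ {m n} → BipGraph m n → BipGraph m n → ℕ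
excess F₀ F = sum (λ v → ∣ F v ∩ ∁ (F₀ v) ∣)

-- Partial matchings and the exchange lemma

module _ {m n : ℕ} where

  record MatchingOutside (E : Fin m → Fin n → Set) (D : Pred (Fin m) 0ℓ) (k : Fin m → Fin n) : Set where
    field
      edge      : ∀ {v} → ¬ D v → E v (k v)
      injective : ∀ {v v′} → ¬ D v → ¬ D v′ → k v ≡ k v′ → v ≡ v′

  open MatchingOutside public

  weaken : ∀ {E E′ D D′ k} → (∀ {v z} → E v z → E′ v z) → (∀ {v} → D v → D′ v) →
           MatchingOutside E D k → MatchingOutside E′ D′ k
  weaken E⊆E′ D⊆D′ M = record
    { edge      = λ ¬D′v → E⊆E′ (edge M (¬D′v ∘ D⊆D′))
    ; injective = λ ¬D′v ¬D′v′ → injective M (¬D′v ∘ D⊆D′) (¬D′v′ ∘ D⊆D′)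
    }

  private
    updateAt-cases : ∀ (k : Fin m → Fin n) p z v →
                     (p ≡ v × updateAt k p (const z) v ≡ z) ⊎ (p ≢ v × updateAt k p (const z) v ≡ k v)
    updateAt-cases k p z v with p ≟ v
    ... | yes refl = inj₁ (refl , updateAt-updates p k)
    ... | no p≢v   = inj₂ (p≢v , updateAt-minimal v p k (p≢v ∘ sym))

  extend : ∀ {E D p z k} → MatchingOutside E (D ∪ ｛ p ｝) k → E p z →
           (∀ {v} → ¬ (D ∪ ｛ p ｝) v → k v ≢ z) → MatchingOutside E D (updateAt k p (const z))
  extend {E} {D} {p} {z} {k} M Epz z-unused = record { edge = edge′ ; injective = injective′ }
    where
    k′ = updateAt k p (const z)
    edge′ : ∀ {v} → ¬ D v → E v (k′ v)
    edge′ {v} ¬Dv with updateAt-cases k p z v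
    ... | inj₁ (refl , k′p≡z) = subst (E p) (sym k′p≡z) Epz
    ... | inj₂ (p≢v , k′v≡kv) = subst (E v) (sym k′v≡kv) (edge M [ ¬Dv , p≢v ])
    injective′ : ∀ {v v′} → ¬ D v → ¬ D v′ → k′ v ≡ k′ v′ → v ≡ v′
    injective′ {v} {v′} ¬Dv ¬Dv′ eq with updateAt-cases k p z v | updateAt-cases k p z v′
    ... | inj₁ (refl , _)     | inj₁ (refl , _)         = refl
    ... | inj₁ (refl , k′p≡z) | inj₂ (p≢v′ , k′v′≡kv′) =
          ⊥-elim (z-unused [ ¬Dv′ , p≢v′ ] (trans (sym k′v′≡kv′) (trans (sym eq) k′p≡z)))
    ... | inj₂ (p≢v , k′v≡kv) | inj₁ (refl , k′p≡z)     =
          ⊥-elim (z-unused [ ¬Dv , p≢v ] (trans (sym k′v≡kv) (trans eq k′p≡z)))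
    ... | inj₂ (p≢v , k′v≡kv) | inj₂ (p≢v′ , k′v′≡kv′) =
          injective M [ ¬Dv , p≢v ] [ ¬Dv′ , p≢v′ ] (trans (sym k′v≡kv) (trans eq k′v′≡kv′))

  reassign : ∀ {E D p q z k} → MatchingOutside E (D ∪ ｛ p ｝) k → E p z →
             ¬ (D ∪ ｛ p ｝) q → k q ≡ z → MatchingOutside E (D ∪ ｛ q ｝) (updateAt k p (const z))
  reassign {D = D} {p} {q} {z} {k} M Epz ¬q kq≡z = extend (weaken id [ inj₁ ∘ inj₁ , inj₂ ] M) Epz unused
    where
    unused : ∀ {v} → ¬ ((D ∪ ｛ q ｝) ∪ ｛ p ｝) v → k v ≢ z
    unused ¬v kv≡z =
      ¬v (inj₁ (inj₂ (injective M ¬q (¬v ∘ [ inj₁ ∘ inj₁ , inj₂ ]) (trans kq≡z (sym kv≡z)))))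

  module _ {E : Fin m → Fin n → Set} {P D : Pred (Fin m) 0ℓ} (P? : Decidable P) (D? : Decidable D)
           {g : Fin m → Fin n} (G : MatchingOutside E P g) where

    Exchanged : Set
    Exchanged = (∃ λ k → MatchingOutside E D k) ⊎ (∃ λ p → P p × ∃ λ k → MatchingOutside E (D ∪ ｛ p ｝) k)

    -- Follow the alternating path y = c₀, c₁, … with h cᵢ₊₁ = g cᵢ, giving each cᵢ its g-partner and
    -- passing the defect on to cᵢ₊₁. Vertices outside rest have been left behind and agree with g,
    -- so the path never returns to them.
    private
      alternate : ∀ (rest : Subset m) → Acc _<_ ∣ rest ∣ → ∀ {c k} → c ∈ rest →
                  MatchingOutside E (D ∪ ｛ c ｝) k →
                  (∀ {v} → v ∉ rest → ¬ P v → ¬ D v → c ≢ v → k v ≡ g v) → Exchanged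
      alternate rest (acc smaller) {c} {k} c∈rest K agrees with P? c | D? c
      ... | yes Pc | _      = inj₂ (c , Pc , k , K)
      ... | no _   | yes Dc = inj₁ (k , weaken id [ id , (λ { refl → Dc }) ] K)
      ... | no ¬Pc | no ¬Dc with any? (λ v → ¬? (D? v) ×-dec ¬? (c ≟ v) ×-dec (k v ≟ g c))
      ...   | no unused =
              inj₁ (_ , extend K (edge G ¬Pc) λ ¬v kv≡gc → unused (_ , ¬v ∘ inj₁ , ¬v ∘ inj₂ , kv≡gc))
      ...   | yes (c′ , ¬Dc′ , c≢c′ , kc′≡gc) with P? c′
      ...     | yes Pc′ = inj₂ (c′ , Pc′ , _ , reassign K (edge G ¬Pc) [ ¬Dc′ , c≢c′ ] kc′≡gc)
      ...     | no ¬Pc′ = alternate (rest - c) (smaller (x∈p⇒∣p-x∣<∣p∣ c∈rest)) c′∈rest-c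
                            (reassign K (edge G ¬Pc) [ ¬Dc′ , c≢c′ ] kc′≡gc) agrees′
        where
        c′∈rest-c : c′ ∈ rest - c
        c′∈rest-c with c′ ∈? rest
        ... | yes c′∈rest = x∈p∧x≢y⇒x∈p-y c′∈rest (c≢c′ ∘ sym)
        ... | no c′∉rest  = ⊥-elim (c≢c′ (injective G ¬Pc ¬Pc′
                              (trans (sym kc′≡gc) (agrees c′∉rest ¬Pc′ ¬Dc′ c≢c′))))
        agrees′ : ∀ {v} → v ∉ rest - c → ¬ P v → ¬ D v → c′ ≢ v → updateAt k c (const (g c)) v ≡ g v
        agrees′ {v} v∉ ¬Pv ¬Dv _ with updateAt-cases k c (g c) v
        ... | inj₁ (refl , k′c≡gc) = k′c≡gc
        ... | inj₂ (c≢v , k′v≡kv)  =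
              trans k′v≡kv (agrees (λ v∈ → v∉ (x∈p∧x≢y⇒x∈p-y v∈ (c≢v ∘ sym))) ¬Pv ¬Dv c≢v)

    exchange : ∀ {y h} → MatchingOutside E (D ∪ ｛ y ｝) h → Exchanged
    exchange H = alternate ⊤ (<-wellFounded _) ∈⊤ H (λ v∉⊤ → ⊥-elim (v∉⊤ ∈⊤))

matching-resp-≗ : ∀ {m n} {G H : BipGraph m n} → G ≗ H → UPerfectMatching G → UPerfectMatching H
matching-resp-≗ G≗H (f , f-inj , f∈G) = f , f-inj , λ v → subst (f v ∈_) (G≗H v) (f∈G v)

module _ {m n : ℕ} (G : BipGraph m n) where

  EdgeAvoiding : Fin n → Fin n → Fin m → Fin n → Set
  EdgeAvoiding α β v z = z ∈ G v × z ≢ α × z ≢ β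

  matching-avoiding : ∀ {f} α β → Injective _≡_ _≡_ f → (∀ v → f v ∈ G v) →
                      MatchingOutside (EdgeAvoiding α β) (λ v → f v ≡ α ⊎ f v ≡ β) f
  matching-avoiding α β f-inj f∈G = record
    { edge      = λ {v} f⁻¹αβ → f∈G v , f⁻¹αβ ∘ inj₁ , f⁻¹αβ ∘ inj₂
    ; injective = λ _ _ → f-inj
    }

  perfect : ∀ {k} → MatchingOutside (λ v z → z ∈ G v) ∅ k → UPerfectMatching G
  perfect {k} M = k , injective M (λ ()) (λ ()) , λ v → edge M (λ ())

  fill₁ : ∀ {α p k} → MatchingOutside (λ v z → z ∈ G v × z ≢ α) ｛ p ｝ k → α ∈ G p → UPerfectMatching G
  fill₁ M α∈Gp = perfect (extend (weaken proj₁ inj₂ M) α∈Gp (λ ¬v → proj₂ (edge M (¬v ∘ inj₂))))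

  fill₂ : ∀ {α β p q k} → MatchingOutside (EdgeAvoiding α β) (｛ p ｝ ∪ ｛ q ｝) k →
          α ∈ G p → β ∈ G q → α ≢ β → UPerfectMatching G
  fill₂ M α∈Gp β∈Gq α≢β =
    fill₁ (extend (weaken (λ (z∈ , z≢α , _) → z∈ , z≢α) id M) (β∈Gq , α≢β ∘ sym)
                  (λ ¬v → proj₂ (proj₂ (edge M ¬v))))
          α∈Gp

-- Compression

module Swap {n : ℕ} (a b : Fin n) where

  τ : Fin n → Fin n
  τ z = transpose a b ⟨$⟩ʳ z

  τ-a : τ a ≡ b
  τ-a with a ≟ a
  ... | yes _  = refl
  ... | no a≢a = ⊥-elim (a≢a refl)

  τ-b : τ b ≡ a
  τ-b with b ≟ a
  ... | yes b≡a = b≡a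
  ... | no _ with b ≟ b
  ...   | yes _  = refl
  ...   | no b≢b = ⊥-elim (b≢b refl)

  τ-fixes : ∀ {z} → z ≢ a → z ≢ b → τ z ≡ z
  τ-fixes {z} z≢a z≢b with z ≟ a
  ... | yes z≡a = ⊥-elim (z≢a z≡a)
  ... | no _ with z ≟ b
  ...   | yes z≡b = ⊥-elim (z≢b z≡b)
  ...   | no _    = refl

  τ-involutive : ∀ z → τ (τ z) ≡ z
  τ-involutive z = by-cases (z ≟ a) (z ≟ b)
    where
    by-cases : Dec (z ≡ a) → Dec (z ≡ b) → τ (τ z) ≡ z
    by-cases (yes refl) _          = trans (cong τ τ-a) τ-b
    by-cases (no _)     (yes refl) = trans (cong τ τ-b) τ-a
    by-cases (no z≢a)   (no z≢b)   = trans (cong τ (τ-fixes z≢a z≢b)) (τ-fixes z≢a z≢b)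

  τ-injective : ∀ {z z′} → τ z ≡ τ z′ → z ≡ z′
  τ-injective {z} {z′} eq = trans (sym (τ-involutive z)) (trans (cong τ eq) (τ-involutive z′))

  swap : Subset n → Subset n
  swap = permute (transpose a b)

  ∈-swap⁺ : ∀ {p z} → τ z ∈ p → z ∈ swap p
  ∈-swap⁺ = ∈-permute⁺ (transpose a b)

  ∈-swap⁻ : ∀ {p z} → z ∈ swap p → τ z ∈ p
  ∈-swap⁻ = ∈-permute⁻ (transpose a b)

  τ∈swap : ∀ {p z} → z ∈ p → τ z ∈ swap p
  τ∈swap {p} {z} z∈p = ∈-swap⁺ (subst (_∈ p) (sym (τ-involutive z)) z∈p)

  a∈swap⁺ : ∀ {p} → b ∈ p → a ∈ swap p
  a∈swap⁺ {p} b∈p = ∈-swap⁺ (subst (_∈ p) (sym τ-a) b∈p)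

  b∈swap⁺ : ∀ {p} → a ∈ p → b ∈ swap p
  b∈swap⁺ {p} a∈p = ∈-swap⁺ (subst (_∈ p) (sym τ-b) a∈p)

  b∈swap⁻ : ∀ {p} → b ∈ swap p → a ∈ p
  b∈swap⁻ {p} b∈swap = subst (_∈ p) τ-b (∈-swap⁻ b∈swap)

  fixed∈swap⁺ : ∀ {p z} → z ≢ a → z ≢ b → z ∈ p → z ∈ swap p
  fixed∈swap⁺ {p} z≢a z≢b z∈p = ∈-swap⁺ (subst (_∈ p) (sym (τ-fixes z≢a z≢b)) z∈p)

  fixed∈swap⁻ : ∀ {p z} → z ≢ a → z ≢ b → z ∈ swap p → z ∈ p
  fixed∈swap⁻ {p} z≢a z≢b z∈swap = subst (_∈ p) (τ-fixes z≢a z≢b) (∈-swap⁻ z∈swap)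

  swap-involutive : ∀ p → swap (swap p) ≡ p
  swap-involutive p = ⊆-antisym
    (λ {z} z∈ → subst (_∈ p) (τ-involutive z) (∈-swap⁻ (∈-swap⁻ z∈)))
    (λ {z} z∈ → subst (_∈ swap (swap p)) (τ-involutive z) (τ∈swap (τ∈swap z∈)))

  swap-⊆ : ∀ {p q} → a ∈ q → b ∈ q → p ⊆ q → swap p ⊆ q
  swap-⊆ {p} {q} a∈q b∈q p⊆q {z} z∈swap with z ≟ a | z ≟ b
  ... | yes refl | _        = a∈q
  ... | no _     | yes refl = b∈q
  ... | no z≢a   | no z≢b   = p⊆q (fixed∈swap⁻ z≢a z≢b z∈swap)

  swap-∩∁-⊆ : ∀ {p q} → a ∉ p → (b ∈ q → a ∈ q) → swap p ∩ ∁ q ⊆ swap (p ∩ ∁ q)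
  swap-∩∁-⊆ {p} {q} a∉p b∈q⇒a∈q {z} z∈ with x∈p∩q⁻ (swap p) (∁ q) z∈
  ... | z∈swap , z∈∁q = ∈-swap⁺ {p ∩ ∁ q} (x∈p∩q⁺ (∈-swap⁻ z∈swap , x∉p⇒x∈∁p (τz∉q (z ≟ a) (z ≟ b))))
    where
    τz∉q : Dec (z ≡ a) → Dec (z ≡ b) → τ z ∉ q
    τz∉q (yes refl) _      τa∈q = x∈∁p⇒x∉p z∈∁q (b∈q⇒a∈q (subst (_∈ q) τ-a τa∈q))
    τz∉q (no _) (yes refl) _    = a∉p (subst (_∈ p) τ-b (∈-swap⁻ z∈swap))
    τz∉q (no z≢a) (no z≢b)      = subst (_∉ q) (sym (τ-fixes z≢a z≢b)) (x∈∁p⇒x∉p z∈∁q)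

  swapIf : ∀ {X : Set} → Dec X → Subset n → Subset n
  swapIf (yes _) = swap
  swapIf (no _)  = id

  ∣swapIf∣ : ∀ {X : Set} (d : Dec X) p → ∣ swapIf d p ∣ ≡ ∣ p ∣
  ∣swapIf∣ (yes _) = ∣permute∣ (transpose a b)
  ∣swapIf∣ (no _)  _ = refl

  swapIf-involutive : ∀ {X : Set} (d : Dec X) p → swapIf d (swapIf d p) ≡ p
  swapIf-involutive (yes _) = swap-involutive
  swapIf-involutive (no _)  _ = refl

  swapIf-mono : ∀ {X : Set} (d : Dec X) {p q} → p ⊆ q → swapIf d p ⊆ swapIf d q
  swapIf-mono (yes _) p⊆q z∈ = ∈-swap⁺ (p⊆q (∈-swap⁻ z∈))
  swapIf-mono (no _)  p⊆q    = p⊆q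

  swapIf-adjoint : ∀ {X : Set} (d : Dec X) {p q} → p ⊆ swapIf d q → swapIf d p ⊆ q
  swapIf-adjoint d {p} {q} p⊆dq z∈ = subst (_ ∈_) (swapIf-involutive d q) (swapIf-mono d p⊆dq z∈)

  fixed∈swapIf : ∀ {X : Set} (d : Dec X) {p z} → z ≢ a → z ≢ b → (z ∈ swapIf d p) ⇔ (z ∈ p)
  fixed∈swapIf (yes _) z≢a z≢b = mk⇔ (fixed∈swap⁻ z≢a z≢b) (fixed∈swap⁺ z≢a z≢b)
  fixed∈swapIf (no _)  _   _   = mk⇔ id id

  module _ {m : ℕ} {S : Pred (Fin m) 0ℓ} (S? : Decidable S) where

    swapRows : BipGraph m n → BipGraph m n
    swapRows G v = swapIf (S? v) (G v)

    swapRows-yes : ∀ G {v} → S v → swapRows G v ≡ swap (G v)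
    swapRows-yes G {v} Sv with S? v
    ... | yes _  = refl
    ... | no ¬Sv = ⊥-elim (¬Sv Sv)

    swapRows-no : ∀ G {v} → ¬ S v → swapRows G v ≡ G v
    swapRows-no G {v} ¬Sv with S? v
    ... | yes Sv = ⊥-elim (¬Sv Sv)
    ... | no _   = refl

    avoiding-swapRows⁺ : ∀ G {v z} → EdgeAvoiding G a b v z → EdgeAvoiding (swapRows G) a b v z
    avoiding-swapRows⁺ G {v} (z∈ , z≢a , z≢b) =
      Equivalence.from (fixed∈swapIf (S? v) z≢a z≢b) z∈ , z≢a , z≢b

    avoiding-swapRows⁻ : ∀ G {v z} → EdgeAvoiding (swapRows G) a b v z → EdgeAvoiding G a b v z
    avoiding-swapRows⁻ G {v} (z∈ , z≢a , z≢b) =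
      Equivalence.to (fixed∈swapIf (S? v) z≢a z≢b) z∈ , z≢a , z≢b

  -- In the application L is an outcome of the compressed graph, T the compressed rows and B the rows
  -- containing both a and b.
  module _ {m : ℕ} (L : BipGraph m n) {T B : Pred (Fin m) 0ℓ} (T? : Decidable T) (B? : Decidable B)
           (T⇒¬B : ∀ {v} → T v → ¬ B v) (b∈⇒B : ∀ {v} → b ∈ L v → B v) where

    a-matched-in-T : ∀ {f} → Injective _≡_ _≡_ f → (∀ v → f v ∈ L v) →
                     ¬ UPerfectMatching (swapRows T? L) → ∃ λ u → T u × f u ≡ a
    a-matched-in-T {f} f-inj f∈L ¬matchable with any? (λ u → T? u ×-dec f u ≟ a)
    ... | yes found = found
    ... | no none   = ⊥-elim (¬matchable (f , f-inj , f∈))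
      where
      f∈ : ∀ v → f v ∈ swapRows T? L v
      f∈ v with T? v
      ... | no _    = f∈L v
      ... | yes Tv  = fixed∈swap⁺ (λ fv≡a → none (v , Tv , fv≡a))
                                  (λ fv≡b → T⇒¬B Tv (b∈⇒B (subst (_∈ L v) fv≡b (f∈L v)))) (f∈L v)

    swapRows-T∪B-matchable : UPerfectMatching L → ¬ UPerfectMatching (swapRows T? L) →
                             UPerfectMatching (swapRows T? (swapRows B? L))
    swapRows-T∪B-matchable (f , f-inj , f∈L) ¬matchable with a-matched-in-T f-inj f∈L ¬matchable
    ... | u , Tu , fu≡a = τ ∘ f , f-inj ∘ τ-injective , τf∈
      where
      τf∈ : ∀ v → τ (f v) ∈ swapRows T? (swapRows B? L) v
      τf∈ v with T? v | B? v
      ... | yes Tv | yes Bv = ⊥-elim (T⇒¬B Tv Bv)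
      ... | yes _  | no _   = τ∈swap (f∈L v)
      ... | no _   | yes _  = τ∈swap (f∈L v)
      ... | no ¬Tv | no ¬Bv = subst (_∈ L v) (sym (τ-fixes fv≢a fv≢b)) (f∈L v)
        where
        fv≢a : f v ≢ a
        fv≢a fv≡a = ¬Tv (subst T (f-inj (trans fu≡a (sym fv≡a))) Tu)
        fv≢b : f v ≢ b
        fv≢b fv≡b = ¬Bv (b∈⇒B (subst (_∈ L v) fv≡b (f∈L v)))

    private
      module Exchanging {g h : Fin m → Fin n}
        (g-inj : Injective _≡_ _≡_ g) (g∈L : ∀ v → g v ∈ L v)
        (h-inj : Injective _≡_ _≡_ h) (h∈H : ∀ v → h v ∈ swapRows B? L v)
        {u : Fin m} (Tu : T u) (gu≡a : g u ≡ a) where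

        G = swapRows T? L

        a≢b : a ≢ b
        a≢b a≡b = T⇒¬B Tu (b∈⇒B (subst (_∈ L u) (trans gu≡a a≡b) (g∈L u)))

        b∈G : ∀ {p} → g p ≡ a ⊎ g p ≡ b → b ∈ G p
        b∈G (inj₁ gp≡a) with g-inj (trans gp≡a (sym gu≡a))
        ... | refl = subst (b ∈_) (sym (swapRows-yes T? L Tu)) (b∈swap⁺ (subst (_∈ L u) gu≡a (g∈L u)))
        b∈G {p} (inj₂ gp≡b) = subst (b ∈_) (sym (swapRows-no T? L (λ Tp → T⇒¬B Tp (b∈⇒B b∈Lp)))) b∈Lp
          where b∈Lp = subst (_∈ L p) gp≡b (g∈L p)

        a∈G : ∀ {x} → h x ≡ b → a ∈ G x
        a∈G {x} hx≡b with B? x | subst (_∈ swapRows B? L x) hx≡b (h∈H x)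
        ... | no ¬Bx | b∈Lx    = ⊥-elim (¬Bx (b∈⇒B b∈Lx))
        ... | yes Bx | b∈swap = subst (a ∈_) (sym (swapRows-no T? L (λ Tx → T⇒¬B Tx Bx))) (b∈swap⁻ b∈swap)

        P? : Decidable (λ v → g v ≡ a ⊎ g v ≡ b)
        P? v = g v ≟ a ⊎-dec g v ≟ b

        D? : Decidable (λ v → h v ≡ b)
        D? v = h v ≟ b

        a-preimage : ∃ λ y → ∀ {v} → h v ≡ a → y ≡ v
        a-preimage with any? (λ y → h y ≟ a)
        ... | yes (y , hy≡a) = y , λ hv≡a → h-inj (trans hy≡a (sym hv≡a))
        ... | no ¬y          = u , λ hv≡a → ⊥-elim (¬y (_ , hv≡a))

        h-outside : ∃ λ y → MatchingOutside (EdgeAvoiding L a b) ((λ v → h v ≡ b) ∪ ｛ y ｝) h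
        h-outside with a-preimage
        ... | y , a-preimage⊆y = y , weaken (avoiding-swapRows⁻ B? L) [ (λ hv≡a → inj₂ (a-preimage⊆y hv≡a)) , inj₁ ]
                                            (matching-avoiding (swapRows B? L) a b h-inj h∈H)

        -- After the exchange at most h⁻¹ b, which can take a, and one p ∈ g⁻¹ {a, b}, which can take b,
        -- are left unmatched.
        G-matchable : UPerfectMatching G
        G-matchable with any? (λ x → h x ≟ b)
                       | exchange P? D? (matching-avoiding L a b g-inj g∈L) (proj₂ h-outside)
        ... | no ¬x | inj₁ (_ , K) =
              perfect G (weaken (proj₁ ∘ avoiding-swapRows⁺ T? L) (λ hv≡b → ¬x (_ , hv≡b)) K)
        ... | no ¬x | inj₂ (_ , Pp , _ , K) =
              fill₁ G (weaken ((λ (z∈ , _ , z≢b) → z∈ , z≢b) ∘ avoiding-swapRows⁺ T? L)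
                              [ (λ hv≡b → ⊥-elim (¬x (_ , hv≡b))) , id ] K)
                    (b∈G Pp)
        ... | yes (x , hx≡b) | inj₁ (_ , K) =
              fill₁ G (weaken ((λ (z∈ , z≢a , _) → z∈ , z≢a) ∘ avoiding-swapRows⁺ T? L)
                              (λ hv≡b → h-inj (trans hx≡b (sym hv≡b))) K)
                    (a∈G hx≡b)
        ... | yes (x , hx≡b) | inj₂ (_ , Pp , _ , K) =
              fill₂ G (weaken (avoiding-swapRows⁺ T? L)
                              [ (λ hv≡b → inj₁ (h-inj (trans hx≡b (sym hv≡b)))) , inj₂ ] K)
                    (a∈G hx≡b) (b∈G Pp) a≢b

    swapRows-T-matchable : UPerfectMatching L → UPerfectMatching (swapRows B? L) →
                           UPerfectMatching (swapRows T? L)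
    swapRows-T-matchable (g , g-inj , g∈L) (h , h-inj , h∈H) with matching? (swapRows T? L)
    ... | yes matchable = matchable
    ... | no ¬matchable with a-matched-in-T g-inj g∈L ¬matchable
    ...   | _ , Tu , gu≡a = Exchanging.G-matchable g-inj g∈L h-inj h∈H Tu gu≡a

  module _ {m : ℕ} {S : Pred (Fin m) 0ℓ} (S? : Decidable S) where

    swapRowsᵛ : Vec (Subset n) m → Vec (Subset n) m
    swapRowsᵛ L = tabulate (swapRows S? (lookup L))

    lookup-swapRowsᵛ : ∀ L → lookup (swapRowsᵛ L) ≗ swapRows S? (lookup L)
    lookup-swapRowsᵛ L = lookup∘tabulate (swapRows S? (lookup L))

    swapRowsᵛ-involutive : ∀ L → swapRowsᵛ (swapRowsᵛ L) ≡ L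
    swapRowsᵛ-involutive L = begin
      tabulate (swapRows S? (lookup (swapRowsᵛ L)))
        ≡⟨ tabulate-cong (λ v → cong (swapIf (S? v)) (lookup-swapRowsᵛ L v)) ⟩
      tabulate (swapRows S? (swapRows S? (lookup L)))
        ≡⟨ tabulate-cong (λ v → swapIf-involutive (S? v) (lookup L v)) ⟩
      tabulate (lookup L)                             ≡⟨ tabulate∘lookup L ⟩
      L                                               ∎
      where open ≡-Reasoning

    swapRowsᵛ-injective : ∀ {L L′} → swapRowsᵛ L ≡ swapRowsᵛ L′ → L ≡ L′
    swapRowsᵛ-injective {L} {L′} eq =
      trans (sym (swapRowsᵛ-involutive L)) (trans (cong swapRowsᵛ eq) (swapRowsᵛ-involutive L′))

    matching-swapRowsᵛ⁺ : ∀ {L} → UPerfectMatching (swapRows S? (lookup L)) →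
                          UPerfectMatching (subgraph (swapRowsᵛ L))
    matching-swapRowsᵛ⁺ {L} = matching-resp-≗ (sym ∘ lookup-swapRowsᵛ L)

    matching-swapRowsᵛ⁻ : ∀ {L} → UPerfectMatching (subgraph (swapRowsᵛ L)) →
                          UPerfectMatching (swapRows S? (lookup L))
    matching-swapRowsᵛ⁻ {L} = matching-resp-≗ (lookup-swapRowsᵛ L)

  outcome-swapRowsᵛ : ∀ {m} {t : Fin m → ℕ} {S : Pred (Fin m) 0ℓ} (S? : Decidable S)
                      {F G : BipGraph m n} →
                      (∀ {v p} → p ⊆ F v → swapIf (S? v) p ⊆ G v) →
                      ∀ L → Outcome t F L → Outcome t G (swapRowsᵛ S? L)
  outcome-swapRowsᵛ {t = t} S? {G = G} rows L L-outcome v =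
    subst (λ r → r ⊆ G v × ∣ r ∣ ≡ t v) (sym (lookup-swapRowsᵛ S? L v))
          (rows (proj₁ (L-outcome v)) , trans (∣swapIf∣ (S? v) (lookup L v)) (proj₂ (L-outcome v)))

  module _ {m : ℕ} (F : BipGraph m n) where

    Compressible : Pred (Fin m) 0ℓ
    Compressible v = b ∈ F v × a ∉ F v

    compressible? : Decidable Compressible
    compressible? v = b ∈? F v ×-dec ¬? (a ∈? F v)

    HasBoth : Pred (Fin m) 0ℓ
    HasBoth v = a ∈ F v × b ∈ F v

    hasBoth? : Decidable HasBoth
    hasBoth? v = a ∈? F v ×-dec b ∈? F v

    Compressible⇒¬HasBoth : ∀ {v} → Compressible v → ¬ HasBoth v
    Compressible⇒¬HasBoth (_ , a∉Fv) (a∈Fv , _) = a∉Fv a∈Fv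

    compress : BipGraph m n
    compress = swapRows compressible? F

    ∣compress∣ : ∀ v → ∣ compress v ∣ ≡ ∣ F v ∣
    ∣compress∣ v = ∣swapIf∣ (compressible? v) (F v)

    b∈compress⇒HasBoth : ∀ {v} → b ∈ compress v → HasBoth v
    b∈compress⇒HasBoth {v} b∈ with compressible? v
    ... | yes (_ , a∉Fv) = ⊥-elim (a∉Fv (b∈swap⁻ b∈))
    ... | no ¬compressible with a ∈? F v
    ...   | yes a∈Fv = a∈Fv , b∈
    ...   | no a∉Fv  = ⊥-elim (¬compressible (b∈ , a∉Fv))

  compress-reduces-excess : ∀ {m} (F₀ F : BipGraph m n) → (∀ {w} → b ∈ F₀ w → a ∈ F₀ w) →
                            ∀ {v} → a ∈ F₀ v → b ∉ F₀ v → b ∈ F v → a ∉ F v →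
                            excess F₀ (compress F) < excess F₀ F
  compress-reduces-excess F₀ F b∈⇒a∈ {v} a∈F₀v b∉F₀v b∈Fv a∉Fv = sum-mono-< row-≤ v row-<
    where
    swapped-⊆ : ∀ {w} → a ∉ F w → swap (F w) ∩ ∁ (F₀ w) ⊆ swap (F w ∩ ∁ (F₀ w))
    swapped-⊆ a∉Fw = swap-∩∁-⊆ a∉Fw b∈⇒a∈

    row-≤ : ∀ w → ∣ compress F w ∩ ∁ (F₀ w) ∣ ≤ ∣ F w ∩ ∁ (F₀ w) ∣
    row-≤ w with compressible? F w
    ... | yes (_ , a∉Fw) =
          ≤-trans (p⊆q⇒∣p∣≤∣q∣ (swapped-⊆ a∉Fw)) (≤-reflexive (∣permute∣ (transpose a b) (F w ∩ ∁ (F₀ w))))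
    ... | no _           = ≤-refl

    row-< : ∣ compress F v ∩ ∁ (F₀ v) ∣ < ∣ F v ∩ ∁ (F₀ v) ∣
    row-< = subst (λ r → ∣ r ∩ ∁ (F₀ v) ∣ < ∣ F v ∩ ∁ (F₀ v) ∣)
                  (sym (swapRows-yes (compressible? F) F (b∈Fv , a∉Fv)))
                  (<-≤-trans (p⊂q⇒∣p∣<∣q∣ (swapped-⊆ a∉Fv , a , a∈ , a∉))
                             (≤-reflexive (∣permute∣ (transpose a b) (F v ∩ ∁ (F₀ v)))))
      where
      a∈ : a ∈ swap (F v ∩ ∁ (F₀ v))
      a∈ = a∈swap⁺ (x∈p∩q⁺ (b∈Fv , x∉p⇒x∈∁p b∉F₀v))
      a∉ : a ∉ swap (F v) ∩ ∁ (F₀ v)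
      a∉ a∈′ = x∈∁p⇒x∉p (proj₂ (x∈p∩q⁻ _ _ a∈′)) a∈F₀v

  module _ {m : ℕ} (t : Fin m → ℕ) (F : BipGraph m n) where

    private
      T? = compressible? F
      B? = hasBoth? F

      β γ : Vec (Subset n) m → Vec (Subset n) m
      β = swapRowsᵛ T?
      γ = swapRowsᵛ B?

      Matchable : Vec (Subset n) m → Set
      Matchable L = UPerfectMatching (subgraph L)

      outcome-β : ∀ L → Outcome t (compress F) L → Outcome t F (β L)
      outcome-β = outcome-swapRowsᵛ T? (swapIf-adjoint (T? _))

      outcome-β⁻ : ∀ L → Outcome t F L → Outcome t (compress F) (β L)
      outcome-β⁻ = outcome-swapRowsᵛ T? (swapIf-mono (T? _))

      outcome-γ : ∀ L → Outcome t (compress F) L → Outcome t (compress F) (γ L)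
      outcome-γ = outcome-swapRowsᵛ B? rows
        where
        rows : ∀ {v p} → p ⊆ compress F v → swapIf (B? v) p ⊆ compress F v
        rows {v} p⊆ with B? v
        ... | no _                   = p⊆
        ... | yes both@(a∈Fv , b∈Fv) =
              subst (_ ⊆_) (sym F′v≡Fv) (swap-⊆ a∈Fv b∈Fv (subst (_ ⊆_) F′v≡Fv p⊆))
          where F′v≡Fv = swapRows-no T? F (λ c → Compressible⇒¬HasBoth F c both)

      lookup-βγ : ∀ L v → lookup (β (γ L)) v ≡ swapRows T? (swapRows B? (lookup L)) v
      lookup-βγ L v = trans (lookup-swapRowsᵛ T? (γ L) v) (cong (swapIf (T? v)) (lookup-swapRowsᵛ B? L v))

      module _ (L : Vec (Subset n) m) (L-outcome : Outcome t (compress F) L) (L-matchable : Matchable L) where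

        b∈⇒HasBoth : ∀ {v} → b ∈ lookup L v → HasBoth F v
        b∈⇒HasBoth {v} b∈ = b∈compress⇒HasBoth F (proj₁ (L-outcome v) b∈)

        βγ-matchable : ¬ Matchable (β L) → Matchable (β (γ L))
        βγ-matchable ¬β-matchable = matching-resp-≗ (sym ∘ lookup-βγ L)
          (swapRows-T∪B-matchable (lookup L) T? B? (Compressible⇒¬HasBoth F) b∈⇒HasBoth
            L-matchable (¬β-matchable ∘ matching-swapRowsᵛ⁺ T? {L}))

        β-matchable : Matchable (γ L) → Matchable (β L)
        β-matchable γ-matchable = matching-swapRowsᵛ⁺ T? {L}
          (swapRows-T-matchable (lookup L) T? B? (Compressible⇒¬HasBoth F) b∈⇒HasBoth
            L-matchable (matching-swapRowsᵛ⁻ B? {L} γ-matchable))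

      -- The two branches have disjoint images by β-matchable.
      ψ : Vec (Subset n) m → Vec (Subset n) m
      ψ L with matching? (subgraph (β L))
      ... | yes _ = β L
      ... | no _  = β (γ L)

      ψ-maps : ∀ {L} → Outcome t (compress F) L × Matchable L → Outcome t F (ψ L) × Matchable (ψ L)
      ψ-maps {L} (o , μ) with matching? (subgraph (β L))
      ... | yes β-matchable  = outcome-β L o , β-matchable
      ... | no ¬β-matchable = outcome-β (γ L) (outcome-γ L o) , βγ-matchable L o μ ¬β-matchable

      ψ-injective : ∀ {L L′} → Outcome t (compress F) L × Matchable L →
                    Outcome t (compress F) L′ × Matchable L′ → ψ L ≡ ψ L′ → L ≡ L′
      ψ-injective {L} {L′} (o , μ) (o′ , μ′) eq
        with matching? (subgraph (β L)) | matching? (subgraph (β L′))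
      ... | yes _  | yes _  = swapRowsᵛ-injective T? eq
      ... | no _   | no _   = swapRowsᵛ-injective B? (swapRowsᵛ-injective T? eq)
      ... | yes _  | no ¬β′ =
            ⊥-elim (¬β′ (β-matchable L′ o′ μ′ (subst Matchable (swapRowsᵛ-injective T? {L} {γ L′} eq) μ)))
      ... | no ¬β  | yes _  =
            ⊥-elim (¬β (β-matchable L o μ (subst Matchable (sym (swapRowsᵛ-injective T? {γ L} {L′} eq)) μ′)))

    #outcomes-compress : #outcomes t (compress F) ≡ #outcomes t F
    #outcomes-compress = ≤-antisym
      (count-≤-injection (outcome? t (compress F)) (outcome? t F) β (λ {L} → outcome-β L)
        (λ _ _ → swapRowsᵛ-injective T?) (allFamilies-unique m n) allFamilies-complete)
      (count-≤-injection (outcome? t F) (outcome? t (compress F)) β (λ {L} → outcome-β⁻ L)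
        (λ _ _ → swapRowsᵛ-injective T?) (allFamilies-unique m n) allFamilies-complete)

    #matchable-compress : #matchable t (compress F) ≤ #matchable t F
    #matchable-compress =
      count-≤-injection (λ L → outcome? t (compress F) L ×-dec matching? (subgraph L))
                        (λ L → outcome? t F L ×-dec matching? (subgraph L))
                        ψ ψ-maps ψ-injective (allFamilies-unique m n) allFamilies-complete

-- Nested families

equal-or-differing-row : ∀ {m n} {F₀ F : BipGraph m n} → (∀ v → ∣ F v ∣ ≡ ∣ F₀ v ∣) →
                         F ≗ F₀ ⊎ ∃ λ v → (∃ λ a → a ∈ F₀ v × a ∉ F v) × (∃ λ b → b ∈ F v × b ∉ F₀ v)
equal-or-differing-row {m} {F₀ = F₀} {F} same-size with all? (λ v → F₀ v ⊆? F v)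
... | yes F₀⊆F = inj₁ (λ v → sym (⊆∧∣≡∣⇒≡ (F₀⊆F v) (sym (same-size v))))
... | no F₀⊈F with ¬∀⟶∃¬ m _ (λ v → F₀ v ⊆? F v) F₀⊈F
...   | v , F₀v⊈Fv = inj₂ (v , ⊈⇒∃∉ F₀v⊈Fv , ⊈⇒∃∉ Fv⊈F₀v)
  where
  Fv⊈F₀v : ¬ F v ⊆ F₀ v
  Fv⊈F₀v Fv⊆F₀v = F₀v⊈Fv (⊆-reflexive (sym (⊆∧∣≡∣⇒≡ Fv⊆F₀v (same-size v))))

-- Equivalently: all neighbourhoods are initial segments of one ordering of Z.
Nested : ∀ {m n} → BipGraph m n → Set
Nested F₀ = ∀ v w → F₀ v ⊆ F₀ w ⊎ F₀ w ⊆ F₀ v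

module _ {m n : ℕ} (t : Fin m → ℕ) {F₀ : BipGraph m n} (nested : Nested F₀) where

  private
    earlier-in-every-row : ∀ {v a b} → a ∈ F₀ v → b ∉ F₀ v → ∀ {w} → b ∈ F₀ w → a ∈ F₀ w
    earlier-in-every-row {v} a∈F₀v b∉F₀v {w} b∈F₀w with nested v w
    ... | inj₁ F₀v⊆F₀w = F₀v⊆F₀w a∈F₀v
    ... | inj₂ F₀w⊆F₀v = ⊥-elim (b∉F₀v (F₀w⊆F₀v b∈F₀w))

    go : ∀ F → Acc _<_ (excess F₀ F) → (∀ v → ∣ F v ∣ ≡ ∣ F₀ v ∣) →
         #outcomes t F ≡ #outcomes t F₀ × #matchable t F₀ ≤ #matchable t F
    go F (acc smaller) same-size with equal-or-differing-row same-size
    ... | inj₁ F≗F₀ = #outcomes-resp-≗ t F≗F₀ , ≤-reflexive (#matchable-resp-≗ t (sym ∘ F≗F₀))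
    ... | inj₂ (v , (a , a∈F₀v , a∉Fv) , (b , b∈Fv , b∉F₀v)) =
          Product.map (trans (sym (#outcomes-compress t F))) (λ ≤F′ → ≤-trans ≤F′ (#matchable-compress t F))
            (go (compress F) (smaller excess-decreases) (λ w → trans (∣compress∣ F w) (same-size w)))
      where
      open Swap a b
      excess-decreases : excess F₀ (compress F) < excess F₀ F
      excess-decreases =
        compress-reduces-excess F₀ F (earlier-in-every-row a∈F₀v b∉F₀v) a∈F₀v b∉F₀v b∈Fv a∉Fv

  nested-minimises-matchable : ∀ F → (∀ v → ∣ F v ∣ ≡ ∣ F₀ v ∣) →
                               #outcomes t F ≡ #outcomes t F₀ × #matchable t F₀ ≤ #matchable t F
  nested-minimises-matchable F = go F (<-wellFounded (excess F₀ F))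

module _ {m n : ℕ} {F₀ : BipGraph m n} {d : Fin m → ℕ} (σ : Permutation′ n)
         (F₀-threshold : ∀ v z → (z ∈ F₀ v) ⇔ (toℕ (σ ⟨$⟩ʳ z) < d v)) where

  private
    open module F₀-threshold v z = Equivalence (F₀-threshold v z) using (to; from)

  threshold-nested : Nested F₀
  threshold-nested v w with ≤-total (d v) (d w)
  ... | inj₁ dv≤dw = inj₁ λ z∈F₀v → from w _ (<-≤-trans (to v _ z∈F₀v) dv≤dw)
  ... | inj₂ dw≤dv = inj₂ λ z∈F₀w → from v _ (<-≤-trans (to w _ z∈F₀w) dw≤dv)

  ∣threshold∣ : (∀ v → d v ≤ n) → ∀ v → ∣ F₀ v ∣ ≡ d v
  ∣threshold∣ d≤n v = begin
    ∣ F₀ v ∣                             ≡⟨ cong ∣_∣ F₀v≡ ⟩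
    ∣ permute σ (initialSegment (d v)) ∣ ≡⟨ ∣permute∣ σ (initialSegment (d v)) ⟩
    ∣ initialSegment {n} (d v) ∣         ≡⟨ ∣initialSegment∣ (d≤n v) ⟩
    d v                                  ∎
    where
    open ≡-Reasoning
    F₀v≡ : F₀ v ≡ permute σ (initialSegment (d v))
    F₀v≡ = ⊆-antisym (λ z∈ → ∈-permute⁺ σ (∈initialSegment⁺ (to v _ z∈)))
                     (λ z∈ → from v _ (∈initialSegment⁻ (∈-permute⁻ σ z∈)))

corollary9p2 : ∀ {m n} (t d : Fin m → ℕ)
    → (∀ v → t v ≤ d v) → (∀ v → d v ≤ n)
    → (F₀ F : BipGraph m n)
    → (∀ v → ∣ F v ∣ ≡ d v)
    → Σ (Permutation′ n) (λ σ → ∀ v z → (z ∈ F₀ v) ⇔ (toℕ (σ ⟨$⟩ʳ z) < d v))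
    → #matchable t F₀ * #outcomes t F ≤ #matchable t F * #outcomes t F₀
-- The hypothesis t v ≤ d v only makes the sample space non-empty; the inequality holds without it.
corollary9p2 t d _ d≤n F₀ F ∣Fv∣≡d (σ , F₀-threshold)
  with nested-minimises-matchable t (threshold-nested σ F₀-threshold) F
         (λ v → trans (∣Fv∣≡d v) (sym (∣threshold∣ σ F₀-threshold d≤n v)))
... | outcomes≡ , matchable≤ rewrite outcomes≡ = *-monoˡ-≤ (#outcomes t F₀) matchable≤
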